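{- Let $T$ be a pure theory. For any formula $A$ of $\mathsf{SE}$, if $T\vdash_{\mathsf{SE}} A$ then $\vdash_{\mathsf{K}} A^\circ$.
   Context: Syntax of $\mathsf{SE}$. There are countably infinite sets of justification constants $\mathsf{JConst}=\{0,1,c_1,c_2,\dots\}$ and justification variables $\mathsf{JVar}$. Terms: constants, variables, and $s\cdot t$, $s+t$ for terms $s,t$. Formulas: $\bot$, atomic propositions $P\in\mathsf{Prop}$, $A\to B$, and $t:A$; $\neg,\wedge,\vee,\leftrightarrow$ are abbreviations. $A[w/t]$ is simultaneous replacement of the variable $w$ by term $t$. Axioms of $\mathsf{SE}$ (for arbitrary formulas $A,B$ and variables $w,x,y,z$): (CL) propositional tautologies; (j) $x:(A\to B)\to(y:A\to x\cdot y:B)$; (j+) $x:A\wedge y:A\to(x+y):A$; (a+) $A[w/(x+y)+z]\to A[w/x+(y+z)]$; (c+) $A[w/x+y]\to A[w/y+x]$; (0+) $A[w/x+0]\leftrightarrow A[w/x]$; (am) $A[w/(x\cdot y)\cdot z]\leftrightarrow A[w/x\cdot(y\cdot z)]$; (a0) $A[w/x\cdot 0]\leftrightarrow A[w/0]$, $A[w/0\cdot x]\leftrightarrow A[w/0]$; (a1) $A[w/x\cdot 1]\leftrightarrow A[w/x]$, $A[w/1\cdot x]\leftrightarrow A[w/x]$; (dl) $A[w/x\cdot(y+z)]\leftrightarrow A[w/x\cdot y+x\cdot z]$; (dr) $A[w/(y+z)\cdot x]\leftrightarrow A[w/y\cdot x+z\cdot x]$. Rules: modus ponens and (jv): from $A$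 infer $A[x/t]$. $T\vdash_{\mathsf{SE}}F$ means $F$ is derivable from axioms and members of the set $T$ by these rules. $\mathsf{K}$ is the basic normal modal logic. For an $\mathsf{SE}$-formula $A$, $A^\circ$ is the modal formula obtained by replacing every occurrence of $s:$ (any term $s$) by $\Box$. A theory $T$ is pure if $\vdash_{\mathsf{K}} A^\circ$ for every $A\in T$. -}

module Defs where

open import Data.Nat using (ℕ; _≟_)
open import Data.Bool using (Bool; true; false; if_then_else_)
open import Relation.Nullary using (yes; no)
open import Relation.Binary.PropositionalEquality using (_≡_)

data JConst : Set where
  c0 : JConst
  c1 : JConst
  c  : ℕ → JConst

JVar : Set
JVar = ℕ

Prop : Set
Prop = ℕ

infixl 7 _·_
infixl 6 _⊕_

data Tm : Set where
  con : JConst → Tm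
  var : JVar → Tm
  _·_ : Tm → Tm → Tm
  _⊕_ : Tm → Tm → Tm

𝟘 𝟙 : Tm
𝟘 = con c0
𝟙 = con c1

infixr 4 _⇒_
infix 5 _∶_

data Fm : Set where
  ⊥̇   : Fm
  atom : Prop → Fm
  _⇒_  : Fm → Fm → Fm
  _∶_  : Tm → Fm → Fm

¬̇_ : Fm → Fm
¬̇ A = A ⇒ ⊥̇

_∧̇_ : Fm → Fm → Fm
A ∧̇ B = ¬̇ (A ⇒ ¬̇ B)

_⇔_ : Fm → Fm → Fm
A ⇔ B = (A ⇒ B) ∧̇ (B ⇒ A)

substTm : Tm → JVar → Tm → Tm
substTm (con k) w t = con k
substTm (var v) w t with v ≟ w
... | yes _ = t
... | no  _ = var v
substTm (s · r) w t = substTm s w t · substTm r w t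
substTm (s ⊕ r) w t = substTm s w t ⊕ substTm r w t

_[_/_] : Fm → JVar → Tm → Fm
⊥̇ [ w / t ] = ⊥̇
atom P [ w / t ] = atom P
(A ⇒ B) [ w / t ] = (A [ w / t ]) ⇒ (B [ w / t ])
(s ∶ A) [ w / t ] = substTm s w t ∶ (A [ w / t ])

-- Propositional tautologies: formulas true under every Boolean valuation
-- of their propositionally atomic parts (atoms P and formulas t:B).
implB : Bool → Bool → Bool
implB true b = b
implB false _ = true

evalJ : (Fm → Bool) → Fm → Bool
evalJ v ⊥̇ = false
evalJ v (atom P) = v (atom P)
evalJ v (A ⇒ B) = implB (evalJ v A) (evalJ v B)
evalJ v (t ∶ A) = v (t ∶ A)

TautJ : Fm → Set
TautJ A = (v : Fm → Bool) → evalJ v A ≡ true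

data AxSE : Fm → Set where
  CL   : ∀ {A} → TautJ A → AxSE A
  j    : ∀ A B (x y : JVar) →
         AxSE ((var x ∶ (A ⇒ B)) ⇒ ((var y ∶ A) ⇒ (var x · var y ∶ B)))
  j+   : ∀ A (x y : JVar) →
         AxSE (((var x ∶ A) ∧̇ (var y ∶ A)) ⇒ ((var x ⊕ var y) ∶ A))
  a+   : ∀ A (w x y z : JVar) →
         AxSE ((A [ w / (var x ⊕ var y) ⊕ var z ]) ⇒ (A [ w / var x ⊕ (var y ⊕ var z) ]))
  c+   : ∀ A (w x y : JVar) →
         AxSE ((A [ w / var x ⊕ var y ]) ⇒ (A [ w / var y ⊕ var x ]))
  0+   : ∀ A (w x : JVar) →
         AxSE ((A [ w / var x ⊕ 𝟘 ]) ⇔ (A [ w / var x ]))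
  am   : ∀ A (w x y z : JVar) →
         AxSE ((A [ w / (var x · var y) · var z ]) ⇔ (A [ w / var x · (var y · var z) ]))
  a0r  : ∀ A (w x : JVar) → AxSE ((A [ w / var x · 𝟘 ]) ⇔ (A [ w / 𝟘 ]))
  a0l  : ∀ A (w x : JVar) → AxSE ((A [ w / 𝟘 · var x ]) ⇔ (A [ w / 𝟘 ]))
  a1r  : ∀ A (w x : JVar) → AxSE ((A [ w / var x · 𝟙 ]) ⇔ (A [ w / var x ]))
  a1l  : ∀ A (w x : JVar) → AxSE ((A [ w / 𝟙 · var x ]) ⇔ (A [ w / var x ]))
  dl   : ∀ A (w x y z : JVar) →
         AxSE ((A [ w / var x · (var y ⊕ var z) ]) ⇔ (A [ w / var x · var y ⊕ var x · var z ]))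
  dr   : ∀ A (w x y z : JVar) →
         AxSE ((A [ w / (var y ⊕ var z) · var x ]) ⇔ (A [ w / var y · var x ⊕ var z · var x ]))

Theory : Set₁
Theory = Fm → Set

infix 2 _⊢SE_

data _⊢SE_ (T : Theory) : Fm → Set where
  ax  : ∀ {A} → AxSE A → T ⊢SE A
  hyp : ∀ {A} → T A → T ⊢SE A
  mp  : ∀ {A B} → T ⊢SE (A ⇒ B) → T ⊢SE A → T ⊢SE B
  jv  : ∀ {A} (x : JVar) (t : Tm) → T ⊢SE A → T ⊢SE (A [ x / t ])

infixr 4 _⇒ₘ_

data MFm : Set where
  ⊥ₘ    : MFm
  atomₘ : Prop → MFm
  _⇒ₘ_  : MFm → MFm → MFm
  □     : MFm → MFm

evalM : (MFm → Bool) → MFm → Bool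
evalM v ⊥ₘ = false
evalM v (atomₘ P) = v (atomₘ P)
evalM v (A ⇒ₘ B) = implB (evalM v A) (evalM v B)
evalM v (□ A) = v (□ A)

TautM : MFm → Set
TautM A = (v : MFm → Bool) → evalM v A ≡ true

infix 2 ⊢K_

data ⊢K_ : MFm → Set where
  taut : ∀ {A} → TautM A → ⊢K A
  axK  : ∀ A B → ⊢K (□ (A ⇒ₘ B) ⇒ₘ (□ A ⇒ₘ □ B))
  mpK  : ∀ {A B} → ⊢K (A ⇒ₘ B) → ⊢K A → ⊢K B
  nec  : ∀ {A} → ⊢K A → ⊢K (□ A)

_° : Fm → MFm
⊥̇ ° = ⊥ₘ
atom P ° = atomₘ P
(A ⇒ B) ° = (A °) ⇒ₘ (B °)
(t ∶ A) ° = □ (A °)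

Pure : Theory → Set
Pure T = ∀ A → T A → ⊢K (A °)

{-# OPTIONS --safe #-}
module Submission where

-- The forgetful projection erases every justification term, so substituting
-- terms is invisible after projection.  Hence each SE axiom other than (j)
-- projects to a propositional tautology (all term-algebra axioms become
-- X → X or X ↔ X, and (j+) becomes □X ∧ □X → □X), (j) projects to the
-- K axiom, and the rule (jv) leaves the projected formula unchanged.

open import Defs
open import Data.Bool using (Bool; true; false)
open import Relation.Binary.PropositionalEquality using (_≡_; refl; sym; trans; cong; cong₂; subst)

°-[/] : ∀ A w t → (A [ w / t ]) ° ≡ A °
°-[/] ⊥̇       w t = refl
°-[/] (atom P) w t = refl
°-[/] (A ⇒ B)  w t = cong₂ _⇒ₘ_ (°-[/] A w t) (°-[/] B w t)
°-[/] (s ∶ A)  w t = cong □ (°-[/] A w t)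

evalJ-° : (v : MFm → Bool) → ∀ A → evalJ (λ F → evalM v (F °)) A ≡ evalM v (A °)
evalJ-° v ⊥̇       = refl
evalJ-° v (atom P) = refl
evalJ-° v (A ⇒ B)  = cong₂ implB (evalJ-° v A) (evalJ-° v B)
evalJ-° v (t ∶ A)  = refl

tautJ⇒⊢K° : ∀ {A} → TautJ A → ⊢K (A °)
tautJ⇒⊢K° {A} tautA = taut λ v → trans (sym (evalJ-° v A)) (tautA (λ F → evalM v (F °)))

⇒-refl-taut : ∀ A → TautJ (A ⇒ A)
⇒-refl-taut A v with evalJ v A
... | true  = refl
... | false = refl

⇔-refl-taut : ∀ A → TautJ (A ⇔ A)
⇔-refl-taut A v with evalJ v A
... | true  = refl
... | false = refl

∧-elimˡ-taut : ∀ A B → TautJ ((A ∧̇ B) ⇒ A)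
∧-elimˡ-taut A B v with evalJ v A | evalJ v B
... | true  | true  = refl
... | true  | false = refl
... | false | _     = refl

⇒-[/]-° : ∀ A w s t → ⊢K (((A [ w / s ]) ⇒ (A [ w / t ])) °)
⇒-[/]-° A w s t rewrite °-[/] A w s | °-[/] A w t = tautJ⇒⊢K° (⇒-refl-taut A)

⇔-[/]-° : ∀ A w s t → ⊢K (((A [ w / s ]) ⇔ (A [ w / t ])) °)
⇔-[/]-° A w s t rewrite °-[/] A w s | °-[/] A w t = tautJ⇒⊢K° (⇔-refl-taut A)

axSE⇒⊢K° : ∀ {A} → AxSE A → ⊢K (A °)
axSE⇒⊢K° (CL tautA)     = tautJ⇒⊢K° tautA
axSE⇒⊢K° (j A B x y)    = axK (A °) (B °)
axSE⇒⊢K° (j+ A x y)     = tautJ⇒⊢K° (∧-elimˡ-taut (var x ∶ A) (var y ∶ A))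
axSE⇒⊢K° (a+ A w x y z) = ⇒-[/]-° A w _ _
axSE⇒⊢K° (c+ A w x y)   = ⇒-[/]-° A w _ _
axSE⇒⊢K° (0+ A w x)     = ⇔-[/]-° A w _ _
axSE⇒⊢K° (am A w x y z) = ⇔-[/]-° A w _ _
axSE⇒⊢K° (a0r A w x)    = ⇔-[/]-° A w _ _
axSE⇒⊢K° (a0l A w x)    = ⇔-[/]-° A w _ _
axSE⇒⊢K° (a1r A w x)    = ⇔-[/]-° A w _ _
axSE⇒⊢K° (a1l A w x)    = ⇔-[/]-° A w _ _
axSE⇒⊢K° (dl A w x y z) = ⇔-[/]-° A w _ _
axSE⇒⊢K° (dr A w x y z) = ⇔-[/]-° A w _ _

mainTheorem8 : (T : Theory) → Pure T → (A : Fm) → (T ⊢SE A) → ⊢K (A °)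
mainTheorem8 T pure A (ax axA)       = axSE⇒⊢K° axA
mainTheorem8 T pure A (hyp A∈T)      = pure A A∈T
mainTheorem8 T pure A (mp ⊢A⇒B ⊢B)   = mpK (mainTheorem8 T pure _ ⊢A⇒B) (mainTheorem8 T pure _ ⊢B)
mainTheorem8 T pure _ (jv {B} x t ⊢B) =
  subst ⊢K_ (sym (°-[/] B x t)) (mainTheorem8 T pure B ⊢B)
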